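{- Let $\mathcal{U}$ be a nonprincipal ultrafilter on $\mathbb{N}$, let $T$ be a tournament on $\mathbb{N}$, and let a $k$-coloring of the edges of $T$ be given. Then for at least one $s\in\{+,-\}$ the following holds: for every $G\in\mathcal{F}^s$ there is a set $V\in\mathcal{U}$ such that there is a monochromatic isomorphic copy of $G$ in $T$ with vertex set $V$.
   Context: A filter on $\mathbb{N}$ is a nonempty family of subsets closed under finite intersections and supersets and not containing $\emptyset$; an ultrafilter $\mathcal{U}$ is a filter such that for every $X\subseteq\mathbb{N}$ either $X\in\mathcal{U}$ or $\mathbb{N}\setminus X\in\mathcal{U}$; it is nonprincipal if all its members are infinite. A tournament on $\mathbb{N}$ is a directed graph with exactly one of $(i,j),(j,i)$ as an edge for each pair $i\neq j$. Let $\mathcal{T}^+$ be the transitive tournament on $\mathbb{N}$ with $(i,j)$ an edge iff $i<j$, and $\mathcal{T}^-$ the one with $(i,j)$ an edge iff $i>j$. For a digraph $D$, $v\in V(D)$, $S\subseteq V(D)$: $d^+(v,S)=|\{u\in S:(v,u)\in E(D)\}|$ and $d^-(v,S)=|\{u\in S:(u,v)\in E(D)\}|$. For $s\in\{+,-\}$ let $\bar{s}$ be the opposite sign. $\mathcal{F}^s$ is the class of countably infinite directed graphs $G$ admitting a partition $V(G)=A\cup B$ into infinite sets such that (1) $G[A]\cong\mathcal{T}^s$ and $B$ is independent; (2) $d^{\bar{s}}(a,B)$ is finite for each $a\in A$; (3) $d^{\bar{s}}(b,A)=0$ for each $b\in B$. A monochromatic isomorphic copy of $G$ in $T$ with vertex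 set $V$ is an injective map $\varphi:V(G)\to\mathbb{N}$ with image $V$ such that $(\varphi(x),\varphi(y))$ is an edge of $T$ for every edge $(x,y)$ of $G$, and all these edges of $T$ have the same color. -}

module Defs where

open import Level using (0ℓ)
open import Data.Nat using (ℕ; _≤_; _<_)
open import Data.Fin using (Fin)
open import Data.Product using (Σ; ∃; ∃-syntax; _×_)
open import Data.Sum using (_⊎_)
open import Data.Empty using (⊥)
open import Relation.Nullary using (¬_)
open import Relation.Binary.PropositionalEquality using (_≡_)
open import Function.Bundles using (_⇔_; _⤖_; Bijection)

Subset : Set₁
Subset = ℕ → Set

_∩_ : Subset → Subset → Subset
(X ∩ Y) n = X n × Y n

∁ : Subset → Subset
∁ X n = ¬ X n

_⊆_ : Subset → Subset → Set
X ⊆ Y = ∀ n → X n → Y n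

Empty : Subset
Empty _ = ⊥

Infinite : Subset → Set
Infinite X = ∀ n → ∃[ m ] (n ≤ m × X m)

Finite : Subset → Set
Finite X = ∃[ n ] (∀ m → X m → m < n)

record IsFilter (U : Subset → Set) : Set₁ where
  field
    nonempty   : ∃[ X ] U X
    ∩-closed   : ∀ X Y → U X → U Y → U (X ∩ Y)
    ⊇-closed   : ∀ X Y → U X → X ⊆ Y → U Y
    no-empty   : ¬ U Empty

record IsNonprincipalUltrafilter (U : Subset → Set) : Set₁ where
  field
    isFilter     : IsFilter U
    ultra        : ∀ X → U X ⊎ U (∁ X)
    nonprincipal : ∀ X → U X → Infinite X

Digraph : Set₁
Digraph = ℕ → ℕ → Set

IsTournament : Digraph → Set
IsTournament T =
  (∀ i → ¬ T i i) ×
  (∀ i j → ¬ i ≡ j → (T i j ⊎ T j i) × ¬ (T i j × T j i))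

data Sign : Set where
  plus minus : Sign

flipSign : Sign → Sign
flipSign plus  = minus
flipSign minus = plus

TT : Sign → Digraph
TT plus  i j = i < j
TT minus i j = j < i

NbrSet : Sign → Digraph → ℕ → Subset → Subset
NbrSet plus  D v S u = S u × D v u
NbrSet minus D v S u = S u × D u v

InF : Sign → Digraph → Set₁
InF s G =
  Σ Subset λ A → Σ Subset λ B →
    (∀ v → A v ⊎ B v) × (∀ v → A v → B v → ⊥) ×
    Infinite A × Infinite B ×
    -- (1) G[A] ≅ 𝒯ˢ  and B independent
    (Σ (Σ ℕ A ⤖ ℕ) λ f → ∀ (x y : Σ ℕ A) →
        G (Data.Product.proj₁ x) (Data.Product.proj₁ y) ⇔
        TT s (Bijection.to f x) (Bijection.to f y)) ×
    (∀ b b' → B b → B b' → ¬ G b b') ×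
    -- (2) d^{s̄}(a,B) finite
    (∀ a → A a → Finite (NbrSet (flipSign s) G a B)) ×
    -- (3) d^{s̄}(b,A) = 0
    (∀ b → B b → ∀ u → ¬ NbrSet (flipSign s) G b A u)

MonoCopy : Digraph → (T : Digraph) → {k : ℕ} → (ℕ → ℕ → Fin k) → Subset → Set
MonoCopy G T {k} c V =
  Σ (ℕ → ℕ) λ φ →
    (∀ x y → φ x ≡ φ y → x ≡ y) ×
    (∀ m → V m ⇔ (∃[ x ] φ x ≡ m)) ×
    ∃[ col ] (∀ x y → G x y → T (φ x) (φ y) × c (φ x) (φ y) ≡ col)

-- Give each vertex v a type t = (s, i): U-almost every u is joined to v by an edge of colour i,
-- directed away from v if s = + and towards v if s = −.  Types exist because U is an ultrafilter
-- and T is a tournament, and as there are only 2k of them, some type class W lies in U.  A graph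
-- G ∈ 𝓕ˢ is then embedded onto W greedily, in an order in which every edge points forward
-- (conditions (2) and (3) of 𝓕ˢ make such an order possible): a vertex of A goes to a vertex of W
-- joined to all earlier images, which exists because finitely many U-large sets meet in a U-large,
-- hence infinite, set; a vertex of B goes to the least unused vertex of W, so that every vertex of
-- W is eventually used.
module Submission where

open import Defs
open import Data.Nat using (ℕ; zero; suc; _+_; _*_; _≤_; _<_; _≟_; z≤n; s≤s)
open import Data.Nat.Properties
open import Data.Nat.Induction using (<-rec)
open import Data.Nat.ListAction using (sum)
open import Data.Fin as Fin using (Fin; zero; suc)
open import Data.Product using (Σ; ∃; ∃-syntax; _×_; _,_; proj₁; proj₂)
open import Data.Product.Properties using (≡-dec)
open import Data.Sum using (_⊎_; inj₁; inj₂)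
open import Data.Empty using (⊥; ⊥-elim)
open import Data.List using (List; []; _∷_)
open import Data.List.Relation.Unary.All as All using (All; []; _∷_)
open import Data.List.Relation.Unary.Any using (here; there)
open import Data.List.Membership.Propositional using (_∈_; _∉_)
open import Data.List.Membership.DecPropositional _≟_ using (_∈?_)
open import Relation.Nullary using (¬_; Dec; yes; no; _×-dec_; ¬?)
open import Relation.Nullary.Decidable using (decidable-stable)
open import Relation.Binary.Definitions using (DecidableEquality; tri<; tri≈; tri>)
open import Relation.Binary.PropositionalEquality using (_≡_; refl; sym; trans; cong; subst)
open import Function using (_∘_)
open import Function.Bundles using (_⇔_; _⤖_; Bijection; Surjection; Equivalence; mk⇔)

Least : (ℕ → Set) → Set
Least P = Σ ℕ λ m → P m × (∀ j → j < m → ¬ P j)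

least : {P : ℕ → Set} → (∀ n → Dec (P n)) → ∀ n → P n → Least P
least {P} P? = <-rec (λ n → P n → Least P) step
  where
  step : ∀ n → (∀ {m} → m < n → P m → Least P) → P n → Least P
  step n rec Pn with anyUpTo? P? n
  ... | yes (m , m<n , Pm) = rec m<n Pm
  ... | no ¬below = n , Pn , λ j j<n Pj → ¬below (j , j<n , Pj)

∈⇒≤sum : ∀ {x xs} → x ∈ xs → x ≤ sum xs
∈⇒≤sum {xs = x ∷ xs} (here refl) = m≤m+n x (sum xs)
∈⇒≤sum {xs = y ∷ xs} (there x∈xs) = ≤-trans (∈⇒≤sum x∈xs) (m≤n+m (sum xs) y)

StrictlyIncreasing : (ℕ → ℕ) → Set
StrictlyIncreasing K = ∀ {i j} → i < j → K i < K j

strictlyIncreasing⇒injective : ∀ {K} → StrictlyIncreasing K → ∀ {i j} → K i ≡ K j → i ≡ j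
strictlyIncreasing⇒injective {K} K-inc {i} {j} Ki≡Kj with <-cmp i j
... | tri< i<j _ _ = ⊥-elim (<⇒≢ (K-inc i<j) Ki≡Kj)
... | tri≈ _ i≡j _ = i≡j
... | tri> _ _ j<i = ⊥-elim (<⇒≢ (K-inc j<i) (sym Ki≡Kj))

strictlyIncreasing-majorant : (h : ℕ → ℕ) → Σ (ℕ → ℕ) λ K → StrictlyIncreasing K × (∀ j → h j ≤ K j)
strictlyIncreasing-majorant h = K , K-inc , K-dom
  where
  K : ℕ → ℕ
  K zero = h zero
  K (suc j) = suc (K j + h (suc j))

  K-inc : StrictlyIncreasing K
  K-inc {i} {suc j} i<1+j with m<1+n⇒m<n∨m≡n i<1+j
  ... | inj₁ i<j = <-trans (K-inc i<j) (s≤s (m≤m+n (K j) _))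
  ... | inj₂ refl = s≤s (m≤m+n (K j) _)

  K-dom : ∀ j → h j ≤ K j
  K-dom zero = ≤-refl
  K-dom (suc j) = m≤n⇒m≤1+n (m≤n+m _ (K j))

increasingOn-unbounded : ∀ {B : Subset} {φ : ℕ → ℕ} → Infinite B →
  (∀ {b b'} → B b → B b' → b < b' → φ b < φ b') → ∀ n → ∃[ b ] B b × n ≤ φ b
increasingOn-unbounded infB φ-inc zero with infB 0
... | b , _ , Bb = b , Bb , z≤n
increasingOn-unbounded infB φ-inc (suc n) with increasingOn-unbounded infB φ-inc n
... | b , Bb , n≤φb with infB (suc b)
...   | b' , b<b' , Bb' = b' , Bb' , ≤-trans (s≤s n≤φb) (φ-inc Bb Bb' b<b')

-- For G ∈ 𝓕ˢ, Arc s G orients the edges of G forward along the order of 𝒯ˢ.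
Arc : Sign → Digraph → Digraph
Arc plus  D v u = D v u
Arc minus D v u = D u v

Arc-reflects : ∀ s {G H : Digraph} (φ : ℕ → ℕ) →
  (∀ p q → Arc s G p q → Arc s H (φ p) (φ q)) → ∀ x y → G x y → H (φ x) (φ y)
Arc-reflects plus  φ arc⇒arc x y = arc⇒arc x y
Arc-reflects minus φ arc⇒arc x y = arc⇒arc y x

Arc⇒NbrSet : ∀ s G {S : Subset} {p q} → S p → Arc s G p q → NbrSet (flipSign s) G q S p
Arc⇒NbrSet plus  G Sp e = Sp , e
Arc⇒NbrSet minus G Sp e = Sp , e

Arc-independent : ∀ s G {B : Subset} → (∀ b b' → B b → B b' → ¬ G b b') →
  ∀ {p q} → B p → B q → ¬ Arc s G p q
Arc-independent plus  G indep Bp Bq = indep _ _ Bp Bq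
Arc-independent minus G indep Bp Bq = indep _ _ Bq Bp

Arc⇒< : ∀ s {G : Digraph} {A : Subset} (f : Σ ℕ A ⤖ ℕ) →
  (∀ x y → G (proj₁ x) (proj₁ y) ⇔ TT s (Bijection.to f x) (Bijection.to f y)) →
  ∀ x y → Arc s G (proj₁ x) (proj₁ y) → Bijection.to f x < Bijection.to f y
Arc⇒< plus  f iso x y = Equivalence.to (iso x y)
Arc⇒< minus f iso x y = Equivalence.to (iso y x)

Monochromatic : (T : Digraph) {k : ℕ} → (ℕ → ℕ → Fin k) → Fin k → Digraph
Monochromatic T c col v u = T v u × c v u ≡ col

Link : (T : Digraph) {k : ℕ} → (ℕ → ℕ → Fin k) → Sign × Fin k → Digraph
Link T c (s , col) = Arc s (Monochromatic T c col)

tournament-linked : ∀ {T} → IsTournament T → ∀ {k} (c : ℕ → ℕ → Fin k) →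
  ∀ {v u} → ¬ v ≡ u → ∃[ t ] Link T c t v u
tournament-linked (_ , oneWay) c {v} {u} v≢u with proj₁ (oneWay v u v≢u)
... | inj₁ Tvu = (plus  , c v u) , Tvu , refl
... | inj₂ Tuv = (minus , c u v) , Tuv , refl

_≟ˢ_ : DecidableEquality Sign
plus  ≟ˢ plus  = yes refl
plus  ≟ˢ minus = no λ ()
minus ≟ˢ plus  = no λ ()
minus ≟ˢ minus = yes refl

module UltrafilterProperties {U : Subset → Set} (isU : IsNonprincipalUltrafilter U) where
  open IsNonprincipalUltrafilter isU
  open IsFilter isFilter

  ≥-large : ∀ m → U (m ≤_)
  ≥-large m with ultra (m ≤_)
  ... | inj₁ U≥ = U≥
  ... | inj₂ U< with nonprincipal _ U< m
  ...   | _ , m≤u , m≰u = ⊥-elim (m≰u m≤u)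

  ∪-prime : ∀ X Y → U (λ u → X u ⊎ Y u) → U X ⊎ U Y
  ∪-prime X Y UX∪Y with ultra X
  ... | inj₁ UX = inj₁ UX
  ... | inj₂ U∁X = inj₂ (⊇-closed _ _ (∩-closed _ _ UX∪Y U∁X) Y-part)
    where
    Y-part : ∀ u → (X u ⊎ Y u) × ¬ X u → Y u
    Y-part u (inj₁ Xu , ¬Xu) = ⊥-elim (¬Xu Xu)
    Y-part u (inj₂ Yu , _) = Yu

  ⋃Fin-prime : ∀ {n} (X : Fin n → Subset) → U (λ u → ∃[ i ] X i u) → ∃[ i ] U (X i)
  ⋃Fin-prime {zero} X U⋃ = ⊥-elim (no-empty (⊇-closed _ _ U⋃ λ _ → λ ()))
  ⋃Fin-prime {suc n} X U⋃ with ∪-prime (X zero) (λ u → ∃[ i ] X (suc i) u) (⊇-closed _ _ U⋃ split)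
    where
    split : ∀ u → ∃[ i ] X i u → X zero u ⊎ ∃[ i ] X (suc i) u
    split u (zero , x) = inj₁ x
    split u (suc i , x) = inj₂ (i , x)
  ... | inj₁ UX₀ = zero , UX₀
  ... | inj₂ U⋃' with ⋃Fin-prime (X ∘ suc) U⋃'
  ...   | i , UXi = suc i , UXi

  ⋃Sign×Fin-prime : ∀ {k} (X : Sign × Fin k → Subset) → U (λ u → ∃[ t ] X t u) → ∃[ t ] U (X t)
  ⋃Sign×Fin-prime X U⋃ with ∪-prime (λ u → ∃[ i ] X (plus , i) u) (λ u → ∃[ i ] X (minus , i) u)
                                       (⊇-closed _ _ U⋃ split)
    where
    split : ∀ u → ∃[ t ] X t u → (∃[ i ] X (plus , i) u) ⊎ (∃[ i ] X (minus , i) u)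
    split u ((plus  , i) , x) = inj₁ (i , x)
    split u ((minus , i) , x) = inj₂ (i , x)
  ... | inj₁ U⁺ with ⋃Fin-prime _ U⁺
  ...   | i , UX = (plus , i) , UX
  ⋃Sign×Fin-prime X U⋃ | inj₂ U⁻ with ⋃Fin-prime _ U⁻
  ...   | i , UX = (minus , i) , UX

  All-large : ∀ (E : ℕ → Subset) {W} → U W → (∀ v → U (E v)) →
    ∀ L → U (λ u → W u × All (λ h → E h u) L)
  All-large E UW UE [] = ⊇-closed _ _ UW λ u Wu → Wu , []
  All-large E UW UE (h ∷ L) = ⊇-closed _ _ (∩-closed _ _ (All-large E UW UE L) (UE h))
    λ { u ((Wu , all) , Ehu) → Wu , Ehu ∷ all }

module LinkTypes {U : Subset → Set} (isU : IsNonprincipalUltrafilter U)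
  {T : Digraph} (tour : IsTournament T) {k : ℕ} (c : ℕ → ℕ → Fin k) where
  open IsNonprincipalUltrafilter isU
  open IsFilter isFilter
  open UltrafilterProperties isU

  linkType : ∀ v → ∃[ t ] U (Link T c t v)
  linkType v = ⋃Sign×Fin-prime (λ t → Link T c t v)
    (⊇-closed _ _ (≥-large (suc v)) λ u v<u → tournament-linked tour c (<⇒≢ v<u))

  Class : Sign × Fin k → Subset
  Class t v = proj₁ (linkType v) ≡ t

  Class? : ∀ t v → Dec (Class t v)
  Class? t v = ≡-dec _≟ˢ_ Fin._≟_ (proj₁ (linkType v)) t

  Class⇒Link : ∀ {t v u} → Class t v → Link T c (proj₁ (linkType v)) v u → Link T c t v u
  Class⇒Link refl link = link

  largeClass : ∃[ t ] U (Class t)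
  largeClass = ⋃Sign×Fin-prime Class (⊇-closed _ _ (≥-large 0) λ v _ → proj₁ (linkType v) , refl)

-- Vertex g of G is embedded at step μ g; the vertices of A must respect E towards all earlier ones.
module GreedyEmbedding {U : Subset → Set} (isU : IsNonprincipalUltrafilter U)
  {W : Subset} (UW : U W) (W? : ∀ v → Dec (W v))
  (E : ℕ → Subset) (UE : ∀ v → U (E v))
  {A B : Subset} (side : ∀ g → A g ⊎ B g) (disjoint : ∀ g → A g → B g → ⊥) (infB : Infinite B)
  (μ : ℕ → ℕ) (μ-injective : ∀ {x y} → μ x ≡ μ y → x ≡ y) (μ-≥ : ∀ g → g ≤ μ g)
  (μ-increasingOn-B : ∀ {b b'} → B b → B b' → b < b' → μ b < μ b')
  where
  open IsNonprincipalUltrafilter isU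
  open UltrafilterProperties isU

  Allowed : List ℕ → Subset
  Allowed L u = W u × All (λ h → E h u) L

  Unused : List ℕ → Subset
  Unused L u = W u × u ∉ L

  beyond : ∀ L → ∃[ u ] (suc (sum L) ≤ u × Allowed L u)
  beyond L = nonprincipal _ (All-large E UW UE L) (suc (sum L))

  leastUnused : ∀ L → Least (Unused L)
  leastUnused L with nonprincipal W UW (suc (sum L))
  ... | w , sumL<w , Ww =
    least (λ u → W? u ×-dec ¬? (u ∈? L)) w (Ww , λ w∈L → <⇒≱ sumL<w (∈⇒≤sum w∈L))

  place : ∀ {g} → A g ⊎ B g → List ℕ → ℕ
  place (inj₁ _) L = proj₁ (beyond L)
  place (inj₂ _) L = proj₁ (leastUnused L)

  place-unused : ∀ {g} (sg : A g ⊎ B g) L → Unused L (place sg L)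
  place-unused (inj₁ _) L with beyond L
  ... | u , sumL<u , Wu , _ = Wu , λ u∈L → <⇒≱ sumL<u (∈⇒≤sum u∈L)
  place-unused (inj₂ _) L = proj₁ (proj₂ (leastUnused L))

  place-allowed : ∀ {g} (sg : A g ⊎ B g) L → A g → All (λ h → E h (place sg L)) L
  place-allowed (inj₁ _) L _ = proj₂ (proj₂ (proj₂ (beyond L)))
  place-allowed (inj₂ Bg) L Ag = ⊥-elim (disjoint _ Ag Bg)

  place-least : ∀ {g} (sg : A g ⊎ B g) L → B g → ∀ {w} → W w → w < place sg L → w ∈ L
  place-least (inj₁ Ag) L Bg = ⊥-elim (disjoint _ Ag Bg)
  place-least (inj₂ _) L _ {w} Ww w<u =
    decidable-stable (w ∈? L) λ w∉L → proj₂ (proj₂ (leastUnused L)) w w<u (Ww , w∉L)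

  preimage? : ∀ m → Dec (∃[ g ] μ g ≡ m)
  preimage? m with anyUpTo? (λ g → μ g ≟ m) (suc m)
  ... | yes (g , _ , μg≡m) = yes (g , μg≡m)
  ... | no ∄ = no λ (g , μg≡m) → ∄ (g , s≤s (subst (g ≤_) μg≡m (μ-≥ g)) , μg≡m)

  -- used m lists the images of the vertices g with μ g < m.
  extend : ∀ {m} → Dec (∃[ g ] μ g ≡ m) → List ℕ → List ℕ
  extend (yes (g , _)) L = place (side g) L ∷ L
  extend (no _) L = L

  used : ℕ → List ℕ
  used zero = []
  used (suc m) = extend (preimage? m) (used m)

  φ : ℕ → ℕ
  φ g = place (side g) (used (μ g))

  extend-⊇ : ∀ {m x L} (d : Dec (∃[ g ] μ g ≡ m)) → x ∈ L → x ∈ extend d L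
  extend-⊇ (yes _) x∈L = there x∈L
  extend-⊇ (no _) x∈L = x∈L

  φ∈used : ∀ {g} m → μ g < m → φ g ∈ used m
  φ∈used {g} (suc m) μg<1+m with m<1+n⇒m<n∨m≡n μg<1+m
  ... | inj₁ μg<m = extend-⊇ (preimage? m) (φ∈used m μg<m)
  ... | inj₂ refl = φ∈extend (preimage? (μ g))
    where
    φ∈extend : (d : Dec (∃[ g' ] μ g' ≡ μ g)) → φ g ∈ extend d (used (μ g))
    φ∈extend (yes (g' , μg'≡μg)) with μ-injective μg'≡μg
    ... | refl = here refl
    φ∈extend (no ∄) = ⊥-elim (∄ (g , refl))

  used⇒φ : ∀ {x} m → x ∈ used m → ∃[ g ] μ g < m × φ g ≡ x
  used⇒φ {x} (suc m) = extend-inv (preimage? m)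
    where
    earlier : ∃[ g ] μ g < m × φ g ≡ x → ∃[ g ] μ g < suc m × φ g ≡ x
    earlier (g , μg<m , φg≡x) = g , m<n⇒m<1+n μg<m , φg≡x

    extend-inv : (d : Dec (∃[ g ] μ g ≡ m)) → x ∈ extend d (used m) → ∃[ g ] μ g < suc m × φ g ≡ x
    extend-inv (yes (g , μg≡m)) (here x≡) =
      g , s≤s (≤-reflexive μg≡m) , trans (cong (place (side g) ∘ used) μg≡m) (sym x≡)
    extend-inv (yes _) (there x∈used) = earlier (used⇒φ m x∈used)
    extend-inv (no _) x∈used = earlier (used⇒φ m x∈used)

  φ∉used : ∀ g → φ g ∉ used (μ g)
  φ∉used g = proj₂ (place-unused (side g) (used (μ g)))

  φ∈W : ∀ g → W (φ g)
  φ∈W g = proj₁ (place-unused (side g) (used (μ g)))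

  φ-injective : ∀ {x y} → φ x ≡ φ y → x ≡ y
  φ-injective {x} {y} φx≡φy with <-cmp (μ x) (μ y)
  ... | tri< μx<μy _ _ = ⊥-elim (φ∉used y (subst (_∈ used (μ y)) φx≡φy (φ∈used _ μx<μy)))
  ... | tri≈ _ μx≡μy _ = μ-injective μx≡μy
  ... | tri> _ _ μy<μx = ⊥-elim (φ∉used x (subst (_∈ used (μ x)) (sym φx≡φy) (φ∈used _ μy<μx)))

  φ-respects-E : ∀ {p q} → A q → μ p < μ q → E (φ p) (φ q)
  φ-respects-E {p} {q} Aq μp<μq =
    All.lookup (place-allowed (side q) (used (μ q)) Aq) (φ∈used (μ q) μp<μq)

  below-φB-hit : ∀ {b w} → B b → W w → w < φ b → ∃[ g ] μ g < μ b × φ g ≡ w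
  below-φB-hit {b} Bb Ww w<φb = used⇒φ (μ b) (place-least (side b) (used (μ b)) Bb Ww w<φb)

  φ-increasingOn-B : ∀ {b b'} → B b → B b' → b < b' → φ b < φ b'
  φ-increasingOn-B {b} {b'} Bb Bb' b<b' with <-cmp (φ b) (φ b')
  ... | tri< φb<φb' _ _ = φb<φb'
  ... | tri≈ _ φb≡φb' _ = ⊥-elim (<⇒≢ b<b' (φ-injective φb≡φb'))
  ... | tri> _ _ φb'<φb with below-φB-hit Bb (φ∈W b') φb'<φb
  ...   | g , μg<μb , φg≡φb' with φ-injective φg≡φb'
  ...     | refl = ⊥-elim (<-asym μg<μb (μ-increasingOn-B Bb Bb' b<b'))

  φ-onto : ∀ {w} → W w → ∃[ g ] φ g ≡ w
  φ-onto {w} Ww with increasingOn-unbounded infB φ-increasingOn-B w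
  ... | b , Bb , w≤φb with m≤n⇒m<n∨m≡n w≤φb
  ...   | inj₂ w≡φb = b , sym w≡φb
  ...   | inj₁ w<φb with below-φB-hit Bb Ww w<φb
  ...     | g , _ , φg≡w = g , φg≡w

module Schedule (s : Sign) {G : Digraph} {A B : Subset}
  (side : ∀ v → A v ⊎ B v) (disjoint : ∀ v → A v → B v → ⊥)
  (f : Σ ℕ A ⤖ ℕ) (iso : ∀ x y → G (proj₁ x) (proj₁ y) ⇔ TT s (Bijection.to f x) (Bijection.to f y))
  (indep : ∀ b b' → B b → B b' → ¬ G b b')
  (fin : ∀ a → A a → Finite (NbrSet (flipSign s) G a B))
  (noback : ∀ b → B b → ∀ u → ¬ NbrSet (flipSign s) G b A u)
  where
  open Bijection f using (to⁻) renaming (to to index; injective to index-injective)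
  open Surjection (Bijection.surjection f) using (to∘to⁻)

  vertex : ℕ → ℕ
  vertex j = proj₁ (to⁻ j)

  vertex-index : ∀ a → vertex (index a) ≡ proj₁ a
  vertex-index a = cong proj₁ (index-injective (to∘to⁻ (index a)))

  inBound : ℕ → ℕ
  inBound j = proj₁ (fin (vertex j) (proj₂ (to⁻ j)))

  majorant : Σ (ℕ → ℕ) λ K → StrictlyIncreasing K × (∀ j → inBound j + vertex j ≤ K j)
  majorant = strictlyIncreasing-majorant (λ j → inBound j + vertex j)

  K : ℕ → ℕ
  K = proj₁ majorant

  K-increasing : StrictlyIncreasing K
  K-increasing = proj₁ (proj₂ majorant)

  vertex≤K : ∀ j → vertex j ≤ K j
  vertex≤K j = ≤-trans (m≤n+m _ (inBound j)) (proj₂ (proj₂ majorant) j)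

  inBound≤K : ∀ j → inBound j ≤ K j
  inBound≤K j = ≤-trans (m≤m+n _ (vertex j)) (proj₂ (proj₂ majorant) j)

  -- The j-th vertex of A takes the odd slot 2 K j + 1, after the slots 2 b of its in-neighbours b ∈ B.
  slot : ∀ {g} → A g ⊎ B g → ℕ
  slot {g} (inj₁ Ag) = suc (2 * K (index (g , Ag)))
  slot {g} (inj₂ _) = 2 * g

  schedule : ℕ → ℕ
  schedule g = slot (side g)

  slot-≥ : ∀ {g} (sg : A g ⊎ B g) → g ≤ slot sg
  slot-≥ {g} (inj₁ Ag) = m≤n⇒m≤1+n (≤-trans g≤K (m≤n*m _ 2))
    where
    g≤K : g ≤ K (index (g , Ag))
    g≤K = subst (_≤ K (index (g , Ag))) (vertex-index (g , Ag)) (vertex≤K _)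
  slot-≥ {g} (inj₂ _) = m≤n*m g 2

  slot-injective : ∀ {x y} (sx : A x ⊎ B x) (sy : A y ⊎ B y) → slot sx ≡ slot sy → x ≡ y
  slot-injective {x} {y} (inj₁ Ax) (inj₁ Ay) e = cong proj₁ (index-injective
    (strictlyIncreasing⇒injective K-increasing
      (*-cancelˡ-≡ (K (index (x , Ax))) (K (index (y , Ay))) 2 (suc-injective e))))
  slot-injective {x} {y} (inj₁ Ax) (inj₂ _) e = ⊥-elim (even≢odd y (K (index (x , Ax))) (sym e))
  slot-injective {x} (inj₂ _) (inj₁ Ay) e = ⊥-elim (even≢odd x (K (index (_ , Ay))) e)
  slot-injective {x} {y} (inj₂ _) (inj₂ _) e = *-cancelˡ-≡ x y 2 e

  slot-B : ∀ {b} (sb : A b ⊎ B b) → B b → slot sb ≡ 2 * b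
  slot-B (inj₁ Ab) Bb = ⊥-elim (disjoint _ Ab Bb)
  slot-B (inj₂ _) _ = refl

  arc-into-A : ∀ {p q} → Arc s G p q → A q
  arc-into-A {p} {q} e with side q | side p
  ... | inj₁ Aq | _ = Aq
  ... | inj₂ Bq | inj₁ Ap = ⊥-elim (noback q Bq p (Arc⇒NbrSet s G Ap e))
  ... | inj₂ Bq | inj₂ Bp = ⊥-elim (Arc-independent s G indep Bp Bq e)

  slot-arc : ∀ {p q} (sp : A p ⊎ B p) (sq : A q ⊎ B q) → Arc s G p q → slot sp < slot sq
  slot-arc {p} {q} (inj₁ Ap) (inj₁ Aq) e =
    s≤s (*-monoʳ-< 2 (K-increasing (Arc⇒< s f iso (p , Ap) (q , Aq) e)))
  slot-arc {p} {q} (inj₂ Bp) (inj₁ Aq) e = s≤s (*-monoʳ-≤ 2 (<⇒≤ (<-≤-trans p<inBound (inBound≤K _))))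
    where
    p<inBound : p < inBound (index (q , Aq))
    p<inBound = proj₂ (fin _ _) p
      (subst (λ v → NbrSet (flipSign s) G v B p) (sym (vertex-index (q , Aq))) (Arc⇒NbrSet s G Bp e))
  slot-arc sp (inj₂ Bq) e = ⊥-elim (disjoint _ (arc-into-A e) Bq)

  schedule-injective : ∀ {x y} → schedule x ≡ schedule y → x ≡ y
  schedule-injective {x} {y} = slot-injective (side x) (side y)

  schedule-≥ : ∀ g → g ≤ schedule g
  schedule-≥ g = slot-≥ (side g)

  schedule-increasingOn-B : ∀ {b b'} → B b → B b' → b < b' → schedule b < schedule b'
  schedule-increasingOn-B {b} {b'} Bb Bb' b<b' rewrite slot-B (side b) Bb | slot-B (side b') Bb' =
    *-monoʳ-< 2 b<b'

  schedule-arc : ∀ {p q} → Arc s G p q → schedule p < schedule q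
  schedule-arc {p} {q} = slot-arc (side p) (side q)

theorem7p3 : (U : Subset → Set) → IsNonprincipalUltrafilter U →
    (T : Digraph) → IsTournament T →
    (k : ℕ) → (c : ℕ → ℕ → Fin k) →
    ∃[ s ] (∀ (G : Digraph) → InF s G →
    Σ Subset λ V → U V × MonoCopy G T c V)
theorem7p3 U isU T tour k c = s , copy
  where
  open LinkTypes isU tour c

  s : Sign
  s = proj₁ (proj₁ largeClass)

  col : Fin k
  col = proj₂ (proj₁ largeClass)

  copy : ∀ G → InF s G → Σ Subset λ V → U V × MonoCopy G T c V
  copy G (A , B , side , disjoint , _ , infB , (f , iso) , indep , fin , noback) =
    Class (s , col) , proj₂ largeClass , φ , (λ _ _ → φ-injective) ,
    (λ m → mk⇔ φ-onto λ { (x , refl) → φ∈W x }) ,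
    col , Arc-reflects s φ λ p q e → Class⇒Link (φ∈W p) (φ-respects-E (arc-into-A e) (schedule-arc e))
    where
    open Schedule s side disjoint f iso indep fin noback
    open GreedyEmbedding isU (proj₂ largeClass) (Class? (s , col))
      (λ v → Link T c (proj₁ (linkType v)) v) (proj₂ ∘ linkType)
      side disjoint infB schedule schedule-injective schedule-≥ schedule-increasingOn-B
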